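{- Let $G$ be a graph without isolated vertices and let $H$ be a nontrivial graph with root $v\in V(H)$. Then $$\gamma_R(G\circ_v H)\in\{n(G)\gamma_R(H),\ \gamma_R(G)+n(G)(\gamma_R(H)-1),\ \gamma(G)+n(G)(\gamma_R(H)-1)\}.$$
   Context: All graphs are finite and simple; a graph is nontrivial if it has at least two vertices; $n(G)=|V(G)|$. For a graph $G$ and a nontrivial graph $H$ with a root $v\in V(H)$, the rooted product graph $G\circ_v H$ is obtained by taking one copy of $G$ and $n(G)$ copies of $H$, and identifying the $i$-th vertex of $G$ with the vertex $v$ in the $i$-th copy of $H$, for each $i$. $\gamma(G)$ is the domination number (minimum size of a set $S$ such that every vertex is in $S$ or adjacent to a vertex of $S$). A Roman dominating function on a graph $X$ is $f:V(X)\to\{0,1,2\}$ such that every vertex with value $0$ has a neighbor with value $2$; $\gamma_R(X)$ is the minimum of $\sum_u f(u)$ over such $f$. -}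

module Defs where

open import Data.Nat using (ℕ; _≤_; _∸_; _+_; _*_)
open import Data.Bool using (Bool; true; false; _∧_; _∨_)
open import Data.Fin using (Fin; remQuot)
open import Data.Fin.Subset using (Subset; _∈_; ∣_∣)
open import Data.List using (map; allFin)
open import Data.Nat.ListAction using (sum)
open import Data.Product using (Σ; ∃; _×_; _,_; proj₁; proj₂)
open import Data.Sum using (_⊎_)
open import Relation.Binary.PropositionalEquality using (_≡_; refl; sym)
open import Data.Empty using (⊥-elim)
open import Relation.Nullary using (¬_; does; yes; no)
import Data.Fin as F

record Graph : Set where
  field
    n       : ℕ
    adj     : Fin n → Fin n → Bool
    adj-sym : ∀ u w → adj u w ≡ adj w u
    adj-irr : ∀ u → adj u u ≡ false
open Graph public

nV : Graph → ℕ
nV G = Graph.n G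

Nontrivial : Graph → Set
Nontrivial H = 2 ≤ nV H

NoIsolated : Graph → Set
NoIsolated G = ∀ (u : Fin (nV G)) → ∃ λ w → adj G u w ≡ true

IsDominating : (G : Graph) → Subset (nV G) → Set
IsDominating G S = ∀ u → u ∈ S ⊎ (∃ λ w → w ∈ S × adj G u w ≡ true)

IsDominationNumber : Graph → ℕ → Set
IsDominationNumber G k =
  (Σ (Subset (nV G)) λ S → IsDominating G S × ∣ S ∣ ≡ k) ×
  (∀ S → IsDominating G S → k ≤ ∣ S ∣)

IsRDF : (G : Graph) → (Fin (nV G) → ℕ) → Set
IsRDF G f = (∀ u → f u ≤ 2) ×
            (∀ u → f u ≡ 0 → ∃ λ w → adj G u w ≡ true × f w ≡ 2)

weight : (G : Graph) → (Fin (nV G) → ℕ) → ℕ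
weight G f = sum (map f (allFin (nV G)))

IsRomanDominationNumber : Graph → ℕ → Set
IsRomanDominationNumber G k =
  (Σ (Fin (nV G) → ℕ) λ f → IsRDF G f × weight G f ≡ k) ×
  (∀ f → IsRDF G f → k ≤ weight G f)

-- Vertex set Fin (n(G) * n(H)); the vertex
-- x with remQuot x = (i , a) is vertex a of the i-th copy of H; vertex i
-- of G is identified with (i , v) (vertex v of the i-th copy of H).
-- (i,a) ~ (j,b)  iff  (i = j and a ~_H b)  or  (a = b = v and i ~_G j).
_==_ : ∀ {m} → Fin m → Fin m → Bool
a == b = does (a F.≟ b)

==-sym : ∀ {m} (a b : Fin m) → (a == b) ≡ (b == a)
==-sym a b with a F.≟ b | b F.≟ a
... | yes _ | yes _ = refl
... | no _ | no _ = refl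
... | yes p | no q = ⊥-elim (q (sym p))
... | no p | yes q = ⊥-elim (p (sym q))

==-refl : ∀ {m} (a : Fin m) → (a == a) ≡ true
==-refl a with a F.≟ a
... | yes _ = refl
... | no p = ⊥-elim (p refl)

pairAdj : (G H : Graph) → Fin (nV H) → Fin (nV G) × Fin (nV H) → Fin (nV G) × Fin (nV H) → Bool
pairAdj G H v (i , a) (j , b) = ((i == j) ∧ adj H a b) ∨ ((a == v) ∧ ((b == v) ∧ adj G i j))

pairAdj-sym : ∀ G H v p q → pairAdj G H v p q ≡ pairAdj G H v q p
pairAdj-sym G H v (i , a) (j , b)
  rewrite ==-sym i j | adj-sym H a b | adj-sym G i j
  with a == v | b == v
... | true | true = refl
... | true | false = refl
... | false | true = refl
... | false | false = refl

pairAdj-irr : ∀ G H v p → pairAdj G H v p p ≡ false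
pairAdj-irr G H v (i , a) rewrite ==-refl i | adj-irr H a | adj-irr G i
  with a == v
... | true = refl
... | false = refl

_∘ᵣ_at_ : (G H : Graph) → Fin (nV H) → Graph
G ∘ᵣ H at v = record
  { n = nV G * nV H
  ; adj = λ x y → pairAdj G H v (remQuot (nV H) x) (remQuot (nV H) y)
  ; adj-sym = λ x y → pairAdj-sym G H v (remQuot (nV H) x) (remQuot (nV H) y)
  ; adj-irr = λ x → pairAdj-irr G H v (remQuot (nV H) x)
  }

-- Let F be a minimum Roman dominating function of G ∘ H and w i the weight of its
-- restriction to the i-th copy of H.  Every restriction is Roman dominating on H except
-- perhaps at the root, so w i ≥ γR(H) − 1, and w i < γR(H) forces the root to be 0 and
-- defended from a neighbouring copy.  If no copy is deficient, γR(G ∘ H) = n γR(H).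
-- Otherwise a deficient copy g gives two constructions: g in every copy with the roots
-- relabelled by a minimum Roman dominating function of G, or g outside and a copy q of
-- weight ≤ γR(H) with root label 2 on a minimum dominating set of G.  Conversely the
-- roots of F project to a Roman dominating function of G, whose support dominates G,
-- and comparing weights copy by copy bounds γR(G ∘ H) below by γ(G) + n(γR(H) − 1), and
-- by γR(G) + n(γR(H) − 1) unless some copy is exactly such a q.

module Submission where

open import Defs

open import Data.Bool using (Bool; true; false; _∧_; _∨_)
open import Data.Bool.Properties using (∨-zeroʳ)
open import Data.Fin as F using (Fin; combine; remQuot; _↑ˡ_; _↑ʳ_)
open import Data.Fin.Properties using (all?; ¬∀⟶∃¬; remQuot-combine; combine-remQuot)
open import Data.Fin.Subset using (Subset; ∣_∣; _∈_)
open import Data.List using (map; tabulate)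
import Data.Nat.ListAction as ListAction
open import Data.Nat using (ℕ; zero; suc; _+_; _*_; _∸_; _≤_; _<_; z≤n; s≤s; _≟_; _≤?_)
open import Data.Nat.Properties
  using ( +-0-commutativeMonoid; +-comm; +-assoc; +-mono-≤; +-monoˡ-≤; ≤-refl; ≤-trans
        ; ≤-reflexive; ≤-antisym; ≤-pred; ≰⇒>; <⇒≱; module ≤-Reasoning )
open import Data.Product using (∃; _×_; _,_; proj₁; proj₂; uncurry)
open import Data.Sum using (_⊎_; inj₁; inj₂)
open import Data.Vec as Vec using (lookup)
open import Data.Vec.Functional using (updateAt)
open import Data.Vec.Functional.Properties using (updateAt-updates; updateAt-minimal)
open import Data.Vec.Properties using (lookup⇒[]=; []=⇒lookup; lookup∘tabulate)
open import Function using (_∘_; const)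
open import Relation.Binary.PropositionalEquality
open import Relation.Nullary using (Dec; yes; no; contradiction)

open import Algebra.Properties.CommutativeMonoid.Sum +-0-commutativeMonoid
  using (sum; sum-syntax; sum-cong-≗; ∑-distrib-+)

∑-const : ∀ n c → ∑[ i < n ] c ≡ n * c
∑-const zero    c = refl
∑-const (suc n) c = cong (c +_) (∑-const n c)

∑-+-const : ∀ {n} (f : Fin n → ℕ) c → ∑[ i < n ] (f i + c) ≡ sum f + n * c
∑-+-const {n} f c = trans (∑-distrib-+ f (const c)) (cong (sum f +_) (∑-const n c))

∑-mono-≤ : ∀ {n} {f g : Fin n → ℕ} → (∀ i → f i ≤ g i) → sum f ≤ sum g
∑-mono-≤ {zero}  f≤g = z≤n
∑-mono-≤ {suc n} f≤g = +-mono-≤ (f≤g F.zero) (∑-mono-≤ (f≤g ∘ F.suc))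

∑-const-≤ : ∀ {n c} {f : Fin n → ℕ} → (∀ i → c ≤ f i) → n * c ≤ sum f
∑-const-≤ {n} {c} c≤f = subst (_≤ _) (∑-const n c) (∑-mono-≤ c≤f)

∑-++ : ∀ m n (f : Fin (m + n) → ℕ) →
       sum f ≡ ∑[ i < m ] f (i ↑ˡ n) + ∑[ j < n ] f (m ↑ʳ j)
∑-++ zero    n f = refl
∑-++ (suc m) n f = trans (cong (f F.zero +_) (∑-++ m n (f ∘ F.suc)))
                         (sym (+-assoc (f F.zero) _ _))

∑-combine : ∀ m n (f : Fin (m * n) → ℕ) →
            sum f ≡ ∑[ i < m ] ∑[ j < n ] f (combine i j)
∑-combine zero    n f = refl
∑-combine (suc m) n f = trans (∑-++ n (m * n) f)
  (cong (∑[ j < n ] f (j ↑ˡ (m * n)) +_) (∑-combine m n (f ∘ (n ↑ʳ_))))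

∑-updateAt-zero : ∀ {n} (f : Fin n → ℕ) i (h : ℕ → ℕ) → f i ≡ 0 →
                  sum (updateAt f i h) ≡ sum f + h 0
∑-updateAt-zero f F.zero    h f0≡0 rewrite f0≡0 = +-comm (h 0) (sum (f ∘ F.suc))
∑-updateAt-zero f (F.suc i) h fi≡0 =
  trans (cong (f F.zero +_) (∑-updateAt-zero (f ∘ F.suc) i h fi≡0))
        (sym (+-assoc (f F.zero) _ (h 0)))

sum-map-tabulate : ∀ {A : Set} {n} (f : A → ℕ) (g : Fin n → A) →
                   ListAction.sum (map f (tabulate g)) ≡ sum (f ∘ g)
sum-map-tabulate {n = zero}  f g = refl
sum-map-tabulate {n = suc n} f g =
  cong (f (g F.zero) +_) (sum-map-tabulate f (g ∘ F.suc))

weight≡∑ : ∀ G f → weight G f ≡ sum f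
weight≡∑ G f = sum-map-tabulate f (λ u → u)

weight-updateAt-zero : ∀ G f v (h : ℕ → ℕ) → f v ≡ 0 →
                       weight G (updateAt f v h) ≡ weight G f + h 0
weight-updateAt-zero G f v h fv≡0 = begin
  weight G (updateAt f v h)  ≡⟨ weight≡∑ G _ ⟩
  sum (updateAt f v h)       ≡⟨ ∑-updateAt-zero f v h fv≡0 ⟩
  sum f + h 0                ≡⟨ cong (_+ h 0) (weight≡∑ G f) ⟨
  weight G f + h 0           ∎
  where open ≡-Reasoning

weight-cong : ∀ G {f g} → f ≗ g → weight G f ≡ weight G g
weight-cong G {f} {g} f≗g =
  trans (weight≡∑ G f) (trans (sum-cong-≗ f≗g) (sym (weight≡∑ G g)))

indicator : Bool → ℕ
indicator true  = 1
indicator false = 0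

∣∣≡∑ : ∀ {n} (S : Subset n) → ∣ S ∣ ≡ ∑[ i < n ] indicator (lookup S i)
∣∣≡∑ Vec.[]          = refl
∣∣≡∑ (true  Vec.∷ S) = cong suc (∣∣≡∑ S)
∣∣≡∑ (false Vec.∷ S) = ∣∣≡∑ S

Defended : (G : Graph) → (Fin (nV G) → ℕ) → Fin (nV G) → Set
Defended G f u = ∃ λ w → adj G u w ≡ true × f w ≡ 2

IsRDFExcept : (G : Graph) → Fin (nV G) → (Fin (nV G) → ℕ) → Set
IsRDFExcept G v f = (∀ u → f u ≤ 2) × (∀ u → u ≢ v → f u ≡ 0 → Defended G f u)

module RomanExcept (G : Graph) (v : Fin (nV G)) where

  isRDF⇒isRDFExcept : ∀ {f} → IsRDF G f → IsRDFExcept G v f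
  isRDF⇒isRDFExcept (f≤2 , defended) = f≤2 , λ u _ → defended u

  isRDFExcept⇒isRDF : ∀ {f} → IsRDFExcept G v f → (f v ≡ 0 → Defended G f v) → IsRDF G f
  isRDFExcept⇒isRDF {f} (f≤2 , defended) defended-v = f≤2 , defended′
    where
    defended′ : ∀ u → f u ≡ 0 → Defended G f u
    defended′ u with u F.≟ v
    ... | yes refl = defended-v
    ... | no  u≢v  = defended u u≢v

  updateAt-defended : ∀ {f u} (h : ℕ → ℕ) → f v ≡ 0 →
                      Defended G f u → Defended G (updateAt f v h) u
  updateAt-defended {f} h fv≡0 (w , uw , fw≡2) =
    w , uw , trans (updateAt-minimal w v f w≢v) fw≡2
    where
    w≢v : w ≢ v
    w≢v refl with trans (sym fv≡0) fw≡2
    ... | ()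

  updateAt-isRDFExcept : ∀ {f} (h : ℕ → ℕ) → IsRDFExcept G v f → f v ≡ 0 → h 0 ≤ 2 →
                         IsRDFExcept G v (updateAt f v h)
  updateAt-isRDFExcept {f} h (f≤2 , defended) fv≡0 h0≤2 = bounded , defended′
    where
    bounded : ∀ u → updateAt f v h u ≤ 2
    bounded u with u F.≟ v
    ... | yes refl = subst (_≤ 2) (sym (trans (updateAt-updates v f) (cong h fv≡0))) h0≤2
    ... | no  u≢v  = subst (_≤ 2) (sym (updateAt-minimal u v f u≢v)) (f≤2 u)
    defended′ : ∀ u → u ≢ v → updateAt f v h u ≡ 0 → Defended G (updateAt f v h) u
    defended′ u u≢v fu≡0 = updateAt-defended h fv≡0
      (defended u u≢v (trans (sym (updateAt-minimal u v f u≢v)) fu≡0))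

  γR≤1+weight : ∀ {f r} → IsRomanDominationNumber G r → IsRDFExcept G v f → f v ≡ 0 →
                r ≤ 1 + weight G f
  γR≤1+weight {f} {r} (_ , γR-min) f-rdf fv≡0 = begin
    r                ≤⟨ γR-min f′ f′-rdf ⟩
    weight G f′      ≡⟨ weight-updateAt-zero G f v suc fv≡0 ⟩
    weight G f + 1   ≡⟨ +-comm (weight G f) 1 ⟩
    1 + weight G f   ∎
    where
    open ≤-Reasoning
    f′ = updateAt f v suc
    f′-rdf : IsRDF G f′
    f′-rdf = isRDFExcept⇒isRDF (updateAt-isRDFExcept suc f-rdf fv≡0 (s≤s z≤n))
      (λ f′v≡0 → contradiction (trans (sym (updateAt-updates v f)) f′v≡0) λ ())

isPositive : ℕ → Bool
isPositive zero    = false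
isPositive (suc _) = true

support : ∀ {n} → (Fin n → ℕ) → Subset n
support f = Vec.tabulate (isPositive ∘ f)

∈-support : ∀ {n} (f : Fin n → ℕ) u → isPositive (f u) ≡ true → u ∈ support f
∈-support f u e = lookup⇒[]= u (support f) (trans (lookup∘tabulate (isPositive ∘ f) u) e)

support-isDominating : ∀ G {f} → IsRDF G f → IsDominating G (support f)
support-isDominating G {f} (_ , defended) u with f u in fu
... | suc _ = inj₁ (∈-support f u (cong isPositive fu))
... | zero  = let (w , uw , fw≡2) = defended u fu
              in inj₂ (w , ∈-support f w (cong isPositive fw≡2) , uw)

∣support∣≡∑ : ∀ {n} (f : Fin n → ℕ) →
              ∣ support f ∣ ≡ ∑[ i < n ] indicator (isPositive (f i))
∣support∣≡∑ f = trans (∣∣≡∑ (support f))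
  (sum-cong-≗ λ i → cong indicator (lookup∘tabulate (isPositive ∘ f) i))

∨-≡true : ∀ x {y} → x ∨ y ≡ true → x ≡ true ⊎ y ≡ true
∨-≡true true  _ = inj₁ refl
∨-≡true false e = inj₂ e

∧-≡true : ∀ x {y} → x ∧ y ≡ true → x ≡ true × y ≡ true
∧-≡true true e = refl , e

==⇒≡ : ∀ {n} {a b : Fin n} → (a == b) ≡ true → a ≡ b
==⇒≡ {a = a} {b} e with a F.≟ b
... | yes a≡b = a≡b

module RootedProduct (G H : Graph) (v : Fin (nV H)) where

  open RomanExcept H v

  private
    N = nV G
    m = nV H
    GH = G ∘ᵣ H at v

  Family : Set
  Family = Fin N → Fin m → ℕ

  copy : (Fin (N * m) → ℕ) → Family
  copy f i a = f (combine i a)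

  glue : Family → Fin (N * m) → ℕ
  glue k x = uncurry k (remQuot {N} m x)

  copy-glue : ∀ k i a → copy (glue k) i a ≡ k i a
  copy-glue k i a = cong (uncurry k) (remQuot-combine {N} i a)

  adj-combine : ∀ i a j b →
                adj GH (combine i a) (combine j b) ≡ pairAdj G H v (i , a) (j , b)
  adj-combine i a j b =
    cong₂ (pairAdj G H v) (remQuot-combine {N} i a) (remQuot-combine {N} j b)

  adj-inCopy : ∀ i {a b} → adj H a b ≡ true → adj GH (combine i a) (combine i b) ≡ true
  adj-inCopy i {a} {b} ab rewrite adj-combine i a i b | ==-refl i | ab = refl

  adj-betweenRoots : ∀ {i j} → adj G i j ≡ true → adj GH (combine i v) (combine j v) ≡ true
  adj-betweenRoots {i} {j} ij rewrite adj-combine i v j v | ==-refl v | ij = ∨-zeroʳ _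

  adj-cases : ∀ i a j b → adj GH (combine i a) (combine j b) ≡ true →
              (i ≡ j × adj H a b ≡ true) ⊎ (a ≡ v × b ≡ v × adj G i j ≡ true)
  adj-cases i a j b e
    with ∨-≡true (i == j ∧ adj H a b) (trans (sym (adj-combine i a j b)) e)
  ... | inj₁ e₁ = let (i≡j , ab) = ∧-≡true (i == j) e₁ in inj₁ (==⇒≡ i≡j , ab)
  ... | inj₂ e₂ = let (a≡v , e₃) = ∧-≡true (a == v) e₂
                      (b≡v , ij) = ∧-≡true (b == v) e₃
                  in inj₂ (==⇒≡ a≡v , ==⇒≡ b≡v , ij)

  ExternallyDefended : Family → Fin N → Set
  ExternallyDefended k i = ∃ λ j → adj G i j ≡ true × k j v ≡ 2

  IsCopywiseRDF : Family → Set
  IsCopywiseRDF k = ∀ i → IsRDFExcept H v (k i) ×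
                          (k i v ≡ 0 → Defended H (k i) v ⊎ ExternallyDefended k i)

  ∀-combine : ∀ {P : Fin (N * m) → Set} → (∀ i a → P (combine i a)) → ∀ x → P x
  ∀-combine {P} p x = subst P (combine-remQuot {N} m x) (uncurry p (remQuot {N} m x))

  neighbour-cases : ∀ {P : Fin (N * m) → Set} i a →
    (∃ λ y → adj GH (combine i a) y ≡ true × P y) →
    (∃ λ b → adj H a b ≡ true × P (combine i b)) ⊎
    (a ≡ v × ∃ λ j → adj G i j ≡ true × P (combine j v))
  neighbour-cases {P} i a (y , xy , Py) =
    cases (subst (λ z → adj GH (combine i a) z ≡ true) (sym y≡jb) xy) (subst P (sym y≡jb) Py)
    where
    j = proj₁ (remQuot {N} m y)
    b = proj₂ (remQuot {N} m y)
    y≡jb : combine j b ≡ y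
    y≡jb = combine-remQuot {N} m y
    cases : adj GH (combine i a) (combine j b) ≡ true → P (combine j b) →
            (∃ λ b → adj H a b ≡ true × P (combine i b)) ⊎
            (a ≡ v × ∃ λ j → adj G i j ≡ true × P (combine j v))
    cases e Pjb with adj-cases i a j b e
    ... | inj₁ (refl , ab)        = inj₁ (b , ab , Pjb)
    ... | inj₂ (refl , refl , ij) = inj₂ (refl , j , ij , Pjb)

  copy-isCopywiseRDF : ∀ {f} → IsRDF GH f → IsCopywiseRDF (copy f)
  copy-isCopywiseRDF {f} (f≤2 , defended) i = (f≤2 ∘ combine i , inCopy) , atRoot
    where
    inCopy : ∀ a → a ≢ v → copy f i a ≡ 0 → Defended H (copy f i) a
    inCopy a a≢v e with neighbour-cases i a (defended (combine i a) e)
    ... | inj₁ d             = d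
    ... | inj₂ (a≡v , _)     = contradiction a≡v a≢v
    atRoot : copy f i v ≡ 0 → Defended H (copy f i) v ⊎ ExternallyDefended (copy f) i
    atRoot e with neighbour-cases i v (defended (combine i v) e)
    ... | inj₁ d             = inj₁ d
    ... | inj₂ (_ , outside) = inj₂ outside

  glue-isRDF : ∀ {k} → IsCopywiseRDF k → IsRDF GH (glue k)
  glue-isRDF {k} k-rdf = ∀-combine bounded , ∀-combine defended
    where
    bounded : ∀ i a → glue k (combine i a) ≤ 2
    bounded i a = subst (_≤ 2) (sym (copy-glue k i a)) (proj₁ (proj₁ (k-rdf i)) a)
    inCopy : ∀ {i a} → Defended H (k i) a → Defended GH (glue k) (combine i a)
    inCopy {i} (b , ab , kib≡2) =
      combine i b , adj-inCopy i ab , trans (copy-glue k i b) kib≡2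
    defended : ∀ i a → glue k (combine i a) ≡ 0 → Defended GH (glue k) (combine i a)
    defended i a e with a F.≟ v
    ... | no a≢v   =
            inCopy (proj₂ (proj₁ (k-rdf i)) a a≢v (trans (sym (copy-glue k i a)) e))
    ... | yes refl with proj₂ (k-rdf i) (trans (sym (copy-glue k i v)) e)
    ...   | inj₁ d                = inCopy d
    ...   | inj₂ (j , ij , kjv≡2) =
              combine j v , adj-betweenRoots ij , trans (copy-glue k j v) kjv≡2

  weight-copies : ∀ f → weight GH f ≡ ∑[ i < N ] weight H (copy f i)
  weight-copies f = begin
    weight GH f                     ≡⟨ weight≡∑ GH f ⟩
    sum f                           ≡⟨ ∑-combine N m f ⟩
    ∑[ i < N ] sum (copy f i)       ≡⟨ sum-cong-≗ (λ i → weight≡∑ H (copy f i)) ⟨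
    ∑[ i < N ] weight H (copy f i)  ∎
    where open ≡-Reasoning

  weight-glue : ∀ k → weight GH (glue k) ≡ ∑[ i < N ] weight H (k i)
  weight-glue k = trans (weight-copies (glue k))
                        (sum-cong-≗ λ i → weight-cong H (copy-glue k i))

  γR≤∑weight : ∀ {γ k} → IsRomanDominationNumber GH γ → IsCopywiseRDF k →
               γ ≤ ∑[ i < N ] weight H (k i)
  γR≤∑weight {k = k} (_ , γR-min) k-rdf =
    ≤-trans (γR-min (glue k) (glue-isRDF k-rdf)) (≤-reflexive (weight-glue k))

  γR≤N*γR : ∀ {γ r} → IsRomanDominationNumber GH γ → IsRomanDominationNumber H r → γ ≤ N * r
  γR≤N*γR {γ} {r} rom-GH ((f , f-rdf , f-weight) , _) = begin
    γ                      ≤⟨ γR≤∑weight rom-GH f-everywhere ⟩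
    ∑[ i < N ] weight H f  ≡⟨ ∑-const N (weight H f) ⟩
    N * weight H f         ≡⟨ cong (N *_) f-weight ⟩
    N * r                  ∎
    where
    open ≤-Reasoning
    f-everywhere : IsCopywiseRDF (λ _ → f)
    f-everywhere _ = isRDF⇒isRDFExcept f-rdf , inj₁ ∘ proj₂ f-rdf v

  γR≤γR+N*weight : ∀ {γ γG g} → IsRomanDominationNumber GH γ → IsRomanDominationNumber G γG →
                   IsRDFExcept H v g → g v ≡ 0 → γ ≤ γG + N * weight H g
  γR≤γR+N*weight {γ} {γG} {g} rom-GH ((φ , φ-rdf , φ-weight) , _) g-rdf gv≡0 = begin
    γ                              ≤⟨ γR≤∑weight rom-GH k-rdf ⟩
    ∑[ j < N ] weight H (k j)      ≡⟨ sum-cong-≗ weight-k ⟩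
    ∑[ j < N ] (φ j + weight H g)  ≡⟨ ∑-+-const φ (weight H g) ⟩
    sum φ + N * weight H g         ≡⟨ cong (_+ N * weight H g) (weight≡∑ G φ) ⟨
    weight G φ + N * weight H g    ≡⟨ cong (_+ N * weight H g) φ-weight ⟩
    γG + N * weight H g            ∎
    where
    open ≤-Reasoning
    k : Family
    k j = updateAt g v (const (φ j))
    kv≡φ : ∀ j → k j v ≡ φ j
    kv≡φ j = updateAt-updates v g
    weight-k : ∀ j → weight H (k j) ≡ φ j + weight H g
    weight-k j =
      trans (weight-updateAt-zero H g v (const (φ j)) gv≡0) (+-comm (weight H g) (φ j))
    k-rdf : IsCopywiseRDF k
    k-rdf j = updateAt-isRDFExcept (const (φ j)) g-rdf gv≡0 (proj₁ φ-rdf j) , atRoot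
      where
      atRoot : k j v ≡ 0 → Defended H (k j) v ⊎ ExternallyDefended k j
      atRoot kjv≡0 = let (j′ , jj′ , φj′≡2) = proj₂ φ-rdf j (trans (sym (kv≡φ j)) kjv≡0)
                     in inj₂ (j′ , jj′ , trans (kv≡φ j′) φj′≡2)

  γR≤γ+N*weight : ∀ {γ γG g q} → IsRomanDominationNumber GH γ → IsDominationNumber G γG →
                  IsRDFExcept H v g → g v ≡ 0 → IsRDF H q → q v ≡ 2 →
                  weight H q ≤ 1 + weight H g → γ ≤ γG + N * weight H g
  γR≤γ+N*weight {γ} {γG} {g} {q} rom-GH ((D , D-dom , ∣D∣≡γG) , _)
                g-rdf gv≡0 q-rdf qv≡2 q≤1+g =
    begin
      γ
        ≤⟨ γR≤∑weight rom-GH k-rdf ⟩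
      ∑[ j < N ] weight H (k j)
        ≤⟨ ∑-mono-≤ (λ j → pick-weight (lookup D j)) ⟩
      ∑[ j < N ] (indicator (lookup D j) + weight H g)
        ≡⟨ ∑-+-const (indicator ∘ lookup D) (weight H g) ⟩
      ∑[ j < N ] indicator (lookup D j) + N * weight H g
        ≡⟨ cong (_+ N * weight H g) (trans (sym (∣∣≡∑ D)) ∣D∣≡γG) ⟩
      γG + N * weight H g
    ∎
    where
    open ≤-Reasoning
    pick : Bool → Fin m → ℕ
    pick true  = q
    pick false = g
    k : Family
    k j = pick (lookup D j)
    pick-weight : ∀ b → weight H (pick b) ≤ indicator b + weight H g
    pick-weight true  = q≤1+g
    pick-weight false = ≤-refl
    outside : ∀ j → lookup D j ≡ false → ExternallyDefended k j
    outside j j∉D with D-dom j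
    ... | inj₁ j∈D = contradiction (trans (sym ([]=⇒lookup j∈D)) j∉D) λ ()
    ... | inj₂ (j′ , j′∈D , jj′) =
            j′ , jj′ , subst (λ b → pick b v ≡ 2) (sym ([]=⇒lookup j′∈D)) qv≡2
    k-rdf : IsCopywiseRDF k
    k-rdf j with lookup D j in j∈?D
    ... | true  = isRDF⇒isRDFExcept q-rdf , inj₁ ∘ proj₂ q-rdf v
    ... | false = g-rdf , λ _ → inj₂ (outside j j∈?D)

  module _ {k : Family} (k-rdf : IsCopywiseRDF k) where

    classify : ∀ i → IsRDF H (k i) ⊎ (k i v ≡ 0 × ExternallyDefended k i)
    classify i with k i v ≟ 0
    ... | no kiv≢0  =
            inj₁ (isRDFExcept⇒isRDF (proj₁ (k-rdf i)) λ kiv≡0 → contradiction kiv≡0 kiv≢0)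
    ... | yes kiv≡0 with proj₂ (k-rdf i) kiv≡0
    ...   | inj₁ d       = inj₁ (isRDFExcept⇒isRDF (proj₁ (k-rdf i)) λ _ → d)
    ...   | inj₂ outside = inj₂ (kiv≡0 , outside)

    project : Fin N → ℕ
    project i with classify i
    ... | inj₂ _ = 0
    ... | inj₁ _ with k i v ≟ 2
    ...   | yes _ = 2
    ...   | no  _ = 1

    project-2 : ∀ i → k i v ≡ 2 → project i ≡ 2
    project-2 i kiv≡2 with classify i
    ... | inj₂ (kiv≡0 , _) = contradiction (trans (sym kiv≡0) kiv≡2) λ ()
    ... | inj₁ _ with k i v ≟ 2
    ...   | yes _      = refl
    ...   | no kiv≢2   = contradiction kiv≡2 kiv≢2

    project-isRDF : IsRDF G project
    project-isRDF = bounded , defended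
      where
      bounded : ∀ i → project i ≤ 2
      bounded i with classify i
      ... | inj₂ _ = z≤n
      ... | inj₁ _ with k i v ≟ 2
      ...   | yes _ = ≤-refl
      ...   | no  _ = s≤s z≤n
      defended : ∀ i → project i ≡ 0 → Defended G project i
      defended i with classify i
      ... | inj₂ (_ , j , ij , kjv≡2) = λ _ → j , ij , project-2 j kjv≡2
      ... | inj₁ _ with k i v ≟ 2
      ...   | yes _ = λ ()
      ...   | no  _ = λ ()

    deficient-copy : ∀ {r} → IsRomanDominationNumber H r → ∀ i → weight H (k i) < r →
                     k i v ≡ 0 × r ≡ 1 + weight H (k i)
    deficient-copy rom-H i w<r with classify i
    ... | inj₁ ki-rdf      = contradiction (proj₂ rom-H (k i) ki-rdf) (<⇒≱ w<r)
    ... | inj₂ (kiv≡0 , _) =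
            kiv≡0 , ≤-antisym (γR≤1+weight rom-H (proj₁ (k-rdf i)) kiv≡0) w<r

    module _ {r} (rom-H : IsRomanDominationNumber H (suc r)) where

      r≤w-deficient : ∀ {i} → k i v ≡ 0 → r ≤ weight H (k i)
      r≤w-deficient {i} kiv≡0 = ≤-pred (γR≤1+weight rom-H (proj₁ (k-rdf i)) kiv≡0)

      copy-weight : ∀ i → project i + r ≤ weight H (k i) ⊎
                          (IsRDF H (k i) × k i v ≡ 2 × weight H (k i) ≤ 1 + r)
      copy-weight i with classify i
      ... | inj₂ (kiv≡0 , _) = inj₁ (r≤w-deficient kiv≡0)
      ... | inj₁ ki-rdf with k i v ≟ 2
      ...   | no  _     = inj₁ (proj₂ rom-H (k i) ki-rdf)
      ...   | yes kiv≡2 with 2 + r ≤? weight H (k i)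
      ...     | yes 2+r≤w = inj₁ 2+r≤w
      ...     | no  2+r≰w = inj₂ (ki-rdf , kiv≡2 , ≤-pred (≰⇒> 2+r≰w))

      support-weight : ∀ i → indicator (isPositive (project i)) + r ≤ weight H (k i)
      support-weight i with classify i
      ... | inj₂ (kiv≡0 , _) = r≤w-deficient kiv≡0
      ... | inj₁ ki-rdf with k i v ≟ 2
      ...   | yes _ = proj₂ rom-H (k i) ki-rdf
      ...   | no  _ = proj₂ rom-H (k i) ki-rdf

      γR+N*r≤∑weight : ∀ {γG} → IsRomanDominationNumber G γG →
                       (∀ i → project i + r ≤ weight H (k i)) →
                       γG + N * r ≤ ∑[ i < N ] weight H (k i)
      γR+N*r≤∑weight {γG} (_ , γR-min) project+r≤w = begin
        γG + N * r                  ≤⟨ +-monoˡ-≤ (N * r) (γR-min project project-isRDF) ⟩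
        weight G project + N * r    ≡⟨ cong (_+ N * r) (weight≡∑ G project) ⟩
        sum project + N * r         ≡⟨ ∑-+-const project r ⟨
        ∑[ i < N ] (project i + r)  ≤⟨ ∑-mono-≤ project+r≤w ⟩
        ∑[ i < N ] weight H (k i)   ∎
        where open ≤-Reasoning

      γ+N*r≤∑weight : ∀ {γG} → IsDominationNumber G γG →
                      γG + N * r ≤ ∑[ i < N ] weight H (k i)
      γ+N*r≤∑weight {γG} (_ , γ-min) = begin
        γG + N * r
          ≤⟨ +-monoˡ-≤ (N * r) (γ-min S (support-isDominating G project-isRDF)) ⟩
        ∣ S ∣ + N * r
          ≡⟨ cong (_+ N * r) (∣support∣≡∑ project) ⟩
        ∑[ i < N ] indicator (isPositive (project i)) + N * r
          ≡⟨ ∑-+-const (indicator ∘ isPositive ∘ project) r ⟨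
        ∑[ i < N ] (indicator (isPositive (project i)) + r)
          ≤⟨ ∑-mono-≤ support-weight ⟩
        ∑[ i < N ] weight H (k i)
        ∎
        where
        open ≤-Reasoning
        S = support project

  module Optimal {γ} (rom-GH : IsRomanDominationNumber GH γ) where

    private
      F = proj₁ (proj₁ rom-GH)

    F-copies : IsCopywiseRDF (copy F)
    F-copies = copy-isCopywiseRDF (proj₁ (proj₂ (proj₁ rom-GH)))

    w : Fin N → ℕ
    w i = weight H (copy F i)

    γ≡∑w : γ ≡ ∑[ i < N ] w i
    γ≡∑w = trans (sym (proj₂ (proj₂ (proj₁ rom-GH)))) (weight-copies F)

    deficient-case : ∀ {γG γRG r} → IsDominationNumber G γG → IsRomanDominationNumber G γRG →
                     IsRomanDominationNumber H r → ∀ i₀ → w i₀ < r →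
                     γ ≡ γRG + N * (r ∸ 1) ⊎ γ ≡ γG + N * (r ∸ 1)
    deficient-case dom-G rom-G rom-H i₀ w<r with deficient-copy F-copies rom-H i₀ w<r
    ... | g₀v≡0 , refl with all? (λ i → project F-copies i + w i₀ ≤? w i)
    ...   | yes fine = inj₁ (≤-antisym
            (γR≤γR+N*weight rom-GH rom-G (proj₁ (F-copies i₀)) g₀v≡0)
            (subst (_ ≤_) (sym γ≡∑w) (γR+N*r≤∑weight F-copies rom-H rom-G fine)))
    ...   | no ¬fine with ¬∀⟶∃¬ N _ (λ i → project F-copies i + w i₀ ≤? w i) ¬fine
    ...     | j₀ , ¬fine-j₀ with copy-weight F-copies rom-H j₀
    ...       | inj₁ fine-j₀                = contradiction fine-j₀ ¬fine-j₀
    ...       | inj₂ (q-rdf , qv≡2 , q≤1+r) = inj₂ (≤-antisym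
            (γR≤γ+N*weight rom-GH dom-G (proj₁ (F-copies i₀)) g₀v≡0 q-rdf qv≡2 q≤1+r)
            (subst (_ ≤_) (sym γ≡∑w) (γ+N*r≤∑weight F-copies rom-H dom-G)))

theorem3p5 : (G H : Graph) (v : Fin (nV H)) →
    NoIsolated G → Nontrivial H →
    (γG γRG γRH γRGH : ℕ) →
    IsDominationNumber G γG →
    IsRomanDominationNumber G γRG →
    IsRomanDominationNumber H γRH →
    IsRomanDominationNumber (G ∘ᵣ H at v) γRGH →
    (γRGH ≡ nV G * γRH)
    ⊎ (γRGH ≡ γRG + nV G * (γRH ∸ 1))
    ⊎ (γRGH ≡ γG + nV G * (γRH ∸ 1))
theorem3p5 G H v _ _ γG γRG γRH γRGH dom-G rom-G rom-H rom-GH =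
  by-cases (all? λ i → γRH ≤? w i)
  where
  open RootedProduct G H v
  open Optimal rom-GH
  by-cases : Dec (∀ i → γRH ≤ w i) →
             (γRGH ≡ nV G * γRH) ⊎ (γRGH ≡ γRG + nV G * (γRH ∸ 1))
             ⊎ (γRGH ≡ γG + nV G * (γRH ∸ 1))
  by-cases (yes full) = inj₁ (≤-antisym
    (γR≤N*γR rom-GH rom-H)
    (subst (_ ≤_) (sym γ≡∑w) (∑-const-≤ full)))
  by-cases (no ¬full) =
    let (i₀ , γRH≰w) = ¬∀⟶∃¬ (nV G) _ (λ i → γRH ≤? w i) ¬full
    in inj₂ (deficient-case dom-G rom-G rom-H i₀ (≰⇒> γRH≰w))
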